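{- Let $T>0$. In the setting described in the context, every feasible solution of SUP whose makespan (as defined for SUP) is at most $T$ is also a feasible solution of SUP' whose makespan (as defined for SUP') is at most $(1+\varepsilon)T$.
   Context: Let $\varepsilon>0$ be rational with $1/\varepsilon\in\mathbb{Z}$. An instance consists of jobs $\mathcal{J}$ with sizes $p_j\ge0$, $m$ identical machines, a positive integer $k$ and a rational $U\ge0$. A solution (for both problems) is a partition of $\mathcal{J}$ into $m$ subsets $\sigma_1,\dots,\sigma_m$, and the makespan is the maximum machine load. SUP: the load of machine $i$ (with $\sigma_i\ne\emptyset$) is $\sum_{j\in\sigma_i}p_j+U\lfloor(|\sigma_i|-1)/k\rfloor$. SUP': sort $\sigma_i$ in non-increasing size order (ties arbitrary); the early jobs $E_i$ are the first $k/\varepsilon$ jobs and the late jobs $\Lambda_i$ are the rest; late jobs have modified size $\tilde p_j=p_j+U/k$. The load of machine $i$ is $\sum_{j\in E_i}p_j+\lfloor(|E_i|-1)/k\rfloor U$ if $|\sigma_i|\le k/\varepsilon$, and $\sum_{j\in E_i}p_j+\sum_{j\in\Lambda_i}\tilde p_j+U/\varepsilon$ if $|\sigma_i|>k/\varepsilon$. -}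

module Defs where

open import Data.Nat as ℕ using (ℕ; zero; suc; _∸_; NonZero)
open import Data.Nat.DivMod using (_/_)
open import Data.Integer using (+_)
open import Data.Rational as ℚ using (ℚ; 0ℚ; 1ℚ; _+_; _*_)
open import Data.Fin using (Fin; _≟_)
open import Data.List using (List; []; _∷_; filter; length; take; drop; allFin; map; foldr)
open import Data.Bool using (if_then_else_)
open import Relation.Nullary.Decidable using (does)

ℕ→ℚ : ℕ → ℚ
ℕ→ℚ n = (+ n) ℚ./ 1

-- ε = 1/q with q a positive natural (ε > 0 rational with 1/ε ∈ ℤ)
epsilon : (q : ℕ) → .{{_ : NonZero q}} → ℚ
epsilon q = (+ 1) ℚ./ q

sumP : {n : ℕ} → (Fin n → ℚ) → List (Fin n) → ℚ
sumP p js = foldr (λ j acc → p j + acc) 0ℚ js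

-- the job set σ_i of machine i under the assignment a (jobs → machines);
-- an assignment is exactly a partition of the jobs into m (possibly empty) subsets
σ : {n m : ℕ} → (Fin n → Fin m) → Fin m → List (Fin n)
σ {n} a i = filter (λ j → a j ≟ i) (allFin n)

supLoad : {n : ℕ} (k : ℕ) → .{{_ : NonZero k}} → (Fin n → ℚ) → ℚ → List (Fin n) → ℚ
supLoad k p U [] = 0ℚ
supLoad k p U js@(_ ∷ _) = sumP p js + U * ℕ→ℚ ((length js ∸ 1) / k)

-- SUP' load of a machine whose jobs, sorted non-increasingly by size, are L.
-- k/ε = k * q.
sup'Load : {n : ℕ} (q k : ℕ) → .{{_ : NonZero q}} → .{{_ : NonZero k}} →
           (Fin n → ℚ) → ℚ → List (Fin n) → ℚ
sup'Load q k p U [] = 0ℚ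
sup'Load q k p U L@(_ ∷ _) =
  if does (length L ℕ.≤? k ℕ.* q)
  then sumP p E + ℕ→ℚ ((length E ∸ 1) / k) * U
  else sumP p E + sumP (λ j → p j + U * ((+ 1) ℚ./ k)) Λ + U * ℕ→ℚ q
  where
    E = take (k ℕ.* q) L
    Λ = drop (k ℕ.* q) L

-- Within the first k/ε jobs SUP' charges setups exactly as SUP does, so short machines keep
-- their load. On a long machine with ℓ jobs, SUP' charges U/k per late job plus U/ε, i.e.
-- ℓ·U/k in total, while SUP charges U⌊(ℓ-1)/k⌋ ≥ ℓ·U/k - U: the overhead is at most one U.
-- That machine already pays at least U⌊(ℓ-1)/k⌋ ≥ U/ε setup cost, so U ≤ εT.
module Submission where

open import Defs
open import Data.Nat using (ℕ; NonZero)
open import Data.Rational using (ℚ; 0ℚ; 1ℚ; _+_; _*_; _≤_; _<_)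
open import Data.Fin using (Fin)
open import Data.List using (List)
open import Data.List.Relation.Unary.Linked using (Linked)
open import Data.List.Relation.Binary.Permutation.Propositional using (_↭_)

open import Data.Nat as ℕ using (suc; _/_; _%_)
import Data.Nat.Properties as ℕₚ
open import Data.Nat.DivMod using (m≡m%n+[m/n]*n; m%n<n; m*n/n≡m; /-monoˡ-≤)
open import Data.Nat.Coprimality using (1-coprimeTo)
import Data.Nat.Coprimality as Coprime
import Data.Integer as ℤ
import Data.Integer.Properties as ℤₚ
open import Data.Rational as ℚ using (mkℚ)
import Data.Rational.Properties as ℚₚ
open import Data.Rational.Solver using (module +-*-Solver)
open import Data.List using ([]; _∷_; length; take; drop; _++_)
open import Data.List.Properties using (take-all; take++drop≡id; length-drop)
open import Data.List.Relation.Binary.Permutation.Propositional as ↭ using ()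
open import Data.List.Relation.Binary.Permutation.Propositional.Properties using (↭-length)
open import Relation.Binary.PropositionalEquality using (_≡_; refl; cong; cong₂; sym; trans; subst; module ≡-Reasoning)
open import Relation.Nullary using (Dec; yes; no)
open import Relation.Nullary.Decidable using (dec-true; dec-false)

open +-*-Solver

ℕ→ℚ≡mkℚ : ∀ n → ℕ→ℚ n ≡ mkℚ (ℤ.+ n) 0 (Coprime.sym (1-coprimeTo n))
ℕ→ℚ≡mkℚ n = ℚₚ.normalize-coprime (Coprime.sym (1-coprimeTo n))

ℕ→ℚ-+ : ∀ m n → ℕ→ℚ (m ℕ.+ n) ≡ ℕ→ℚ m + ℕ→ℚ n
ℕ→ℚ-+ m n rewrite ℕ→ℚ≡mkℚ m | ℕ→ℚ≡mkℚ n =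
  ℚₚ./-cong (cong₂ ℤ._+_ (sym (ℤₚ.*-identityʳ (ℤ.+ m))) (sym (ℤₚ.*-identityʳ (ℤ.+ n)))) refl

ℕ→ℚ-* : ∀ m n → ℕ→ℚ (m ℕ.* n) ≡ ℕ→ℚ m * ℕ→ℚ n
ℕ→ℚ-* m n rewrite ℕ→ℚ≡mkℚ m | ℕ→ℚ≡mkℚ n = ℚₚ./-cong (ℤₚ.pos-* m n) refl

ℕ→ℚ-mono-≤ : ∀ {m n} → m ℕ.≤ n → ℕ→ℚ m ≤ ℕ→ℚ n
ℕ→ℚ-mono-≤ {m} {n} m≤n rewrite ℕ→ℚ≡mkℚ m | ℕ→ℚ≡mkℚ n =
  ℚ.*≤* (ℤₚ.*-monoʳ-≤-nonNeg (ℤ.+ 1) (ℤ.+≤+ m≤n))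

ℕ→ℚ*epsilon≡1 : ∀ k .{{_ : NonZero k}} → ℕ→ℚ k * epsilon k ≡ 1ℚ
ℕ→ℚ*epsilon≡1 (suc k) rewrite ℕ→ℚ≡mkℚ (suc k) | ℚₚ.normalize-coprime {1} {k} (1-coprimeTo (suc k)) =
  ℚₚ.*-inverseʳ (mkℚ (ℤ.+ suc k) 0 (Coprime.sym (1-coprimeTo (suc k))))

epsilon-nonNeg : ∀ k .{{_ : NonZero k}} → 0ℚ ≤ epsilon k
epsilon-nonNeg k = ℚₚ.nonNegative⁻¹ (epsilon k) {{ℚₚ.normalize-nonNeg 1 k}}

ℕ→ℚ-*-epsilon : ∀ k .{{_ : NonZero k}} m x → ℕ→ℚ (k ℕ.* m) * (x * epsilon k) ≡ x * ℕ→ℚ m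
ℕ→ℚ-*-epsilon k m x = begin
  ℕ→ℚ (k ℕ.* m) * (x * epsilon k)      ≡⟨ cong (_* (x * epsilon k)) (ℕ→ℚ-* k m) ⟩
  ℕ→ℚ k * ℕ→ℚ m * (x * epsilon k)      ≡⟨ solve 4 (λ K M x e → K :* M :* (x :* e) := x :* M :* (K :* e))
                                              refl (ℕ→ℚ k) (ℕ→ℚ m) x (epsilon k) ⟩
  x * ℕ→ℚ m * (ℕ→ℚ k * epsilon k)      ≡⟨ cong (x * ℕ→ℚ m *_) (ℕ→ℚ*epsilon≡1 k) ⟩
  x * ℕ→ℚ m * 1ℚ                        ≡⟨ ℚₚ.*-identityʳ (x * ℕ→ℚ m) ⟩
  x * ℕ→ℚ m                             ∎
  where open ≡-Reasoning

m<n*[1+m/n] : ∀ m n .{{_ : NonZero n}} → m ℕ.< n ℕ.* suc (m / n)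
m<n*[1+m/n] m n = begin-strict
  m                    ≡⟨ m≡m%n+[m/n]*n m n ⟩
  m % n ℕ.+ m / n ℕ.* n <⟨ ℕₚ.+-monoˡ-< (m / n ℕ.* n) (m%n<n m n) ⟩
  suc (m / n) ℕ.* n    ≡⟨ ℕₚ.*-comm (suc (m / n)) n ⟩
  n ℕ.* suc (m / n)    ∎
  where open ℕₚ.≤-Reasoning

module _ {n : ℕ} (p : Fin n → ℚ) where

  sumP-↭ : ∀ {xs ys : List (Fin n)} → xs ↭ ys → sumP p xs ≡ sumP p ys
  sumP-↭ ↭.refl = refl
  sumP-↭ (↭.prep x xs↭ys) = cong (p x +_) (sumP-↭ xs↭ys)
  sumP-↭ {ys = y ∷ x ∷ ys} (↭.swap x y xs↭ys) = trans (cong (λ s → p x + (p y + s)) (sumP-↭ xs↭ys))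
    (solve 3 (λ a b s → a :+ (b :+ s) := b :+ (a :+ s)) refl (p x) (p y) (sumP p ys))
  sumP-↭ (↭.trans xs↭ys ys↭zs) = trans (sumP-↭ xs↭ys) (sumP-↭ ys↭zs)

  sumP-++ : ∀ xs ys → sumP p (xs ++ ys) ≡ sumP p xs + sumP p ys
  sumP-++ [] ys = sym (ℚₚ.+-identityˡ (sumP p ys))
  sumP-++ (x ∷ xs) ys = trans (cong (p x +_) (sumP-++ xs ys)) (sym (ℚₚ.+-assoc (p x) _ _))

  sumP-nonNeg : (∀ j → 0ℚ ≤ p j) → ∀ xs → 0ℚ ≤ sumP p xs
  sumP-nonNeg p≥0 [] = ℚₚ.≤-refl
  sumP-nonNeg p≥0 (x ∷ xs) = ℚₚ.+-mono-≤ (p≥0 x) (sumP-nonNeg p≥0 xs)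

  sumP-+-const : ∀ c xs → sumP (λ j → p j + c) xs ≡ sumP p xs + ℕ→ℚ (length xs) * c
  sumP-+-const c [] = sym (trans (ℚₚ.+-identityˡ _) (ℚₚ.*-zeroˡ c))
  sumP-+-const c (x ∷ xs) = begin
    p x + c + sumP (λ j → p j + c) xs             ≡⟨ cong (p x + c +_) (sumP-+-const c xs) ⟩
    p x + c + (sumP p xs + ℕ→ℚ (length xs) * c)   ≡⟨ solve 4 (λ a c s l → a :+ c :+ (s :+ l :* c) := a :+ s :+ (con 1ℚ :+ l) :* c)
                                                      refl (p x) c (sumP p xs) (ℕ→ℚ (length xs)) ⟩
    p x + sumP p xs + (1ℚ + ℕ→ℚ (length xs)) * c  ≡⟨ cong (λ l → p x + sumP p xs + l * c) (sym (ℕ→ℚ-+ 1 (length xs))) ⟩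
    p x + sumP p xs + ℕ→ℚ (suc (length xs)) * c   ∎
    where open ≡-Reasoning

*ℕ→ℚ≤⇒≤epsilon* : ∀ q .{{_ : NonZero q}} {x y} → x * ℕ→ℚ q ≤ y → x ≤ epsilon q * y
*ℕ→ℚ≤⇒≤epsilon* q {x} {y} xq≤y = begin
  x                         ≡⟨ sym (ℚₚ.*-identityʳ x) ⟩
  x * 1ℚ                    ≡⟨ cong (x *_) (sym (ℕ→ℚ*epsilon≡1 q)) ⟩
  x * (ℕ→ℚ q * epsilon q)   ≡⟨ sym (ℚₚ.*-assoc x (ℕ→ℚ q) (epsilon q)) ⟩
  x * ℕ→ℚ q * epsilon q     ≤⟨ ℚₚ.*-monoʳ-≤-nonNeg (epsilon q) {{ℚ.nonNegative (epsilon-nonNeg q)}} xq≤y ⟩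
  y * epsilon q             ≡⟨ ℚₚ.*-comm y (epsilon q) ⟩
  epsilon q * y             ∎
  where open ℚₚ.≤-Reasoning

≤[1+epsilon]* : ∀ q .{{_ : NonZero q}} {x} → 0ℚ ≤ x → x ≤ (1ℚ + epsilon q) * x
≤[1+epsilon]* q {x} x≥0 = begin
  x                        ≡⟨ sym (ℚₚ.*-identityˡ x) ⟩
  1ℚ * x                   ≤⟨ ℚₚ.*-monoʳ-≤-nonNeg x {{ℚ.nonNegative x≥0}} (ℚₚ.+-monoʳ-≤ 1ℚ (epsilon-nonNeg q)) ⟩
  (1ℚ + epsilon q) * x     ∎
  where open ℚₚ.≤-Reasoning

module _ (k : ℕ) .{{_ : NonZero k}} {n : ℕ} (p : Fin n → ℚ) (U : ℚ) where

  supLoad-↭ : ∀ {xs ys : List (Fin n)} → xs ↭ ys → supLoad k p U xs ≡ supLoad k p U ys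
  supLoad-↭ {[]}    {[]}    _ = refl
  supLoad-↭ {[]}    {_ ∷ _} xs↭ys with () ← ↭-length xs↭ys
  supLoad-↭ {_ ∷ _} {[]}    xs↭ys with () ← ↭-length xs↭ys
  supLoad-↭ {_ ∷ _} {_ ∷ _} xs↭ys =
    cong₂ (λ s ℓ → s + U * ℕ→ℚ ((ℓ ℕ.∸ 1) / k)) (sumP-↭ p xs↭ys) (↭-length xs↭ys)

module _ (q k : ℕ) .{{_ : NonZero q}} .{{_ : NonZero k}} {n : ℕ} (p : Fin n → ℚ) (U : ℚ) where

  sup'Load-short : ∀ xs → length xs ℕ.≤ k ℕ.* q → sup'Load q k p U xs ≡ supLoad k p U xs
  sup'Load-short []          _     = refl
  sup'Load-short xs@(_ ∷ ys) short
    rewrite dec-true (length xs ℕ.≤? k ℕ.* q) short | take-all (k ℕ.* q) xs short =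
    cong (sumP p xs +_) (ℚₚ.*-comm (ℕ→ℚ (length ys / k)) U)

  sup'Load-long : 0ℚ ≤ U → ∀ xs → k ℕ.* q ℕ.< length xs → sup'Load q k p U xs ≤ supLoad k p U xs + U
  sup'Load-long U≥0 xs@(_ ∷ ys) long rewrite dec-false (length xs ℕ.≤? k ℕ.* q) (ℕₚ.<⇒≱ long) = begin
    sumP p E + sumP (λ j → p j + c) Λ + U * ℕ→ℚ q
      ≡⟨ cong (λ s → sumP p E + s + U * ℕ→ℚ q) (sumP-+-const p c Λ) ⟩
    sumP p E + (sumP p Λ + ℕ→ℚ (length Λ) * c) + U * ℕ→ℚ q
      ≡⟨ solve 5 (λ e l Λ c u → e :+ (l :+ Λ :* c) :+ u := (e :+ l) :+ (Λ :* c :+ u))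
           refl (sumP p E) (sumP p Λ) (ℕ→ℚ (length Λ)) c (U * ℕ→ℚ q) ⟩
    (sumP p E + sumP p Λ) + (ℕ→ℚ (length Λ) * c + U * ℕ→ℚ q)
      ≡⟨ cong₂ _+_ early+late late+setup ⟩
    sumP p xs + ℕ→ℚ (length xs) * c
      ≤⟨ ℚₚ.+-monoʳ-≤ (sumP p xs) (ℚₚ.*-monoʳ-≤-nonNeg c {{ℚ.nonNegative c≥0}} (ℕ→ℚ-mono-≤ (m<n*[1+m/n] (length ys) k))) ⟩
    sumP p xs + ℕ→ℚ (k ℕ.* suc f) * c
      ≡⟨ cong (sumP p xs +_) (trans (ℕ→ℚ-*-epsilon k (suc f) U) (cong (U *_) (ℕ→ℚ-+ 1 f))) ⟩
    sumP p xs + U * (1ℚ + ℕ→ℚ f)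
      ≡⟨ solve 3 (λ s u f → s :+ u :* (con 1ℚ :+ f) := s :+ u :* f :+ u) refl (sumP p xs) U (ℕ→ℚ f) ⟩
    sumP p xs + U * ℕ→ℚ f + U
      ∎
    where
    open ℚₚ.≤-Reasoning
    E Λ : List (Fin n)
    E = take (k ℕ.* q) xs
    Λ = drop (k ℕ.* q) xs
    c : ℚ
    c = U * epsilon k
    f : ℕ
    f = length ys / k
    c≥0 : 0ℚ ≤ c
    c≥0 = ℚₚ.nonNegative⁻¹ c {{ℚₚ.nonNeg*nonNeg⇒nonNeg U {{ℚ.nonNegative U≥0}} (epsilon k) {{ℚ.nonNegative (epsilon-nonNeg k)}}}}
    early+late : sumP p E + sumP p Λ ≡ sumP p xs
    early+late = trans (sym (sumP-++ p E Λ)) (cong (sumP p) (take++drop≡id (k ℕ.* q) xs))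
    late+early-count : length Λ ℕ.+ k ℕ.* q ≡ length xs
    late+early-count = trans (cong (ℕ._+ k ℕ.* q) (length-drop (k ℕ.* q) xs)) (ℕₚ.m∸n+n≡m (ℕₚ.<⇒≤ long))
    late+setup : ℕ→ℚ (length Λ) * c + U * ℕ→ℚ q ≡ ℕ→ℚ (length xs) * c
    late+setup = begin-equality
      ℕ→ℚ (length Λ) * c + U * ℕ→ℚ q                ≡⟨ cong (ℕ→ℚ (length Λ) * c +_) (sym (ℕ→ℚ-*-epsilon k q U)) ⟩
      ℕ→ℚ (length Λ) * c + ℕ→ℚ (k ℕ.* q) * c       ≡⟨ sym (ℚₚ.*-distribʳ-+ c (ℕ→ℚ (length Λ)) _) ⟩
      (ℕ→ℚ (length Λ) + ℕ→ℚ (k ℕ.* q)) * c         ≡⟨ cong (_* c) (sym (ℕ→ℚ-+ (length Λ) (k ℕ.* q))) ⟩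
      ℕ→ℚ (length Λ ℕ.+ k ℕ.* q) * c               ≡⟨ cong (λ ℓ → ℕ→ℚ ℓ * c) late+early-count ⟩
      ℕ→ℚ (length xs) * c                          ∎

  U*q≤supLoad : (∀ j → 0ℚ ≤ p j) → 0ℚ ≤ U → ∀ xs → k ℕ.* q ℕ.< length xs → U * ℕ→ℚ q ≤ supLoad k p U xs
  U*q≤supLoad p≥0 U≥0 xs@(_ ∷ ys) long = begin
    U * ℕ→ℚ q                   ≤⟨ ℚₚ.*-monoˡ-≤-nonNeg U {{ℚ.nonNegative U≥0}} (ℕ→ℚ-mono-≤ q≤f) ⟩
    U * ℕ→ℚ f                   ≡⟨ sym (ℚₚ.+-identityˡ (U * ℕ→ℚ f)) ⟩
    0ℚ + U * ℕ→ℚ f              ≤⟨ ℚₚ.+-monoˡ-≤ (U * ℕ→ℚ f) (sumP-nonNeg p p≥0 xs) ⟩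
    sumP p xs + U * ℕ→ℚ f       ∎
    where
    open ℚₚ.≤-Reasoning
    f : ℕ
    f = length ys / k
    q≤f : q ℕ.≤ f
    q≤f = subst (ℕ._≤ f) (trans (cong (_/ k) (ℕₚ.*-comm k q)) (m*n/n≡m q k)) (/-monoˡ-≤ k (ℕₚ.≤-pred long))

lemma2 : (q : ℕ) → .{{_ : NonZero q}} →
    (n m k : ℕ) → .{{_ : NonZero k}} →
    (p : Fin n → ℚ) → (∀ j → 0ℚ ≤ p j) →
    (U : ℚ) → 0ℚ ≤ U →
    (T : ℚ) → 0ℚ < T →
    (a : Fin n → Fin m) →
    (∀ i → supLoad k p U (σ a i) ≤ T) →
    ∀ i (L : List (Fin n)) → L ↭ σ a i →
    Linked (λ x y → p y ≤ p x) L →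
    sup'Load q k p U L ≤ (1ℚ + epsilon q) * T
lemma2 q n m k p p≥0 U U≥0 T T>0 a fits i L L↭σᵢ _ = by-length (length L ℕ.≤? k ℕ.* q)
  where
  open ℚₚ.≤-Reasoning

  load≤T : supLoad k p U L ≤ T
  load≤T = subst (_≤ T) (sym (supLoad-↭ k p U L↭σᵢ)) (fits i)

  by-length : Dec (length L ℕ.≤ k ℕ.* q) → sup'Load q k p U L ≤ (1ℚ + epsilon q) * T
  by-length (yes short) = begin
    sup'Load q k p U L          ≡⟨ sup'Load-short q k p U L short ⟩
    supLoad k p U L             ≤⟨ load≤T ⟩
    T                           ≤⟨ ≤[1+epsilon]* q (ℚₚ.<⇒≤ T>0) ⟩
    (1ℚ + epsilon q) * T        ∎
  by-length (no ¬short) = begin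
    sup'Load q k p U L          ≤⟨ sup'Load-long q k p U U≥0 L long ⟩
    supLoad k p U L + U         ≤⟨ ℚₚ.+-mono-≤ load≤T U≤εT ⟩
    T + epsilon q * T           ≡⟨ solve 2 (λ T ε → T :+ ε :* T := (con 1ℚ :+ ε) :* T) refl T (epsilon q) ⟩
    (1ℚ + epsilon q) * T        ∎
    where
    long : k ℕ.* q ℕ.< length L
    long = ℕₚ.≰⇒> ¬short
    U≤εT : U ≤ epsilon q * T
    U≤εT = *ℕ→ℚ≤⇒≤epsilon* q (ℚₚ.≤-trans (U*q≤supLoad q k p U p≥0 U≥0 L long) load≤T)
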